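{- Let $\Sigma$ be an implicational base over a finite set $U$ with closure system $\mathcal{C}$, and let $(U_1,U_2)$ be an acyclic split of $\Sigma$. Let $C_1\in\mathcal{C}_1$ and $C_2\in\mathcal{C}_2$. If $C_1\cup C_2\in\mathcal{C}$, then $C_1'\cup C_2\in\mathcal{C}$ for every $C_1'\in\mathcal{C}_1$ with $C_1'\subseteq C_1$.
   Context: An implication over $U$ is written $A \to b$ with $A \subseteq U$ nonempty and $b \in U$; an implicational base is a finite set of implications. $C\subseteq U$ satisfies $\Sigma$ if for all $A\to b\in\Sigma$, $A\subseteq C$ implies $b\in C$; the closure system of $\Sigma$ is the family of subsets satisfying $\Sigma$. For $X\subseteq U$, $\Sigma[X]=\{A\to b\in\Sigma: A\cup\{b\}\subseteq X\}$. A split of $\Sigma$ is a bipartition $(U_1,U_2)$ of $U$ into nonempty disjoint sets such that every premise is contained in $U_1$ or in $U_2$; $\Sigma[U_1,U_2]:=\Sigma\setminus(\Sigma[U_1]\cup\Sigma[U_2])$. The split is acyclic if $A\subseteq U_1$ for every $A\to b\in\Sigma[U_1,U_2]$. $\mathcal{C}_1$, $\mathcal{C}_2$ denote the closure systems of $\Sigma[U_1]$ (over $U_1$) and $\Sigma[U_2]$ (over $U_2$). -}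

module Defs where

open import Data.Nat using (ℕ)
open import Data.Fin using (Fin)
open import Data.Fin.Subset using (Subset; _⊆_; _∈_; _∉_; _∪_; ∁; Nonempty)
open import Data.List using (List)
open import Data.List.Membership.Propositional renaming (_∈_ to _∈ₗ_)
open import Data.Product using (_×_)
open import Data.Sum using (_⊎_)
open import Relation.Nullary using (¬_)

record Implication (n : ℕ) : Set where
  constructor _⇒_∣_
  field
    premise    : Subset n
    conclusion : Fin n
    nonempty   : Nonempty premise
open Implication public

Base : ℕ → Set
Base n = List (Implication n)

Satisfies : ∀ {n} → Base n → Subset n → Set
Satisfies {n} Σ C = ∀ (i : Implication n) → i ∈ₗ Σ → premise i ⊆ C → conclusion i ∈ C

InClosure : ∀ {n} → Base n → Subset n → Set
InClosure Σ C = Satisfies Σ C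

InsideOf : ∀ {n} → Subset n → Implication n → Set
InsideOf X i = premise i ⊆ X × conclusion i ∈ X

-- C belongs to the closure system of Σ[X] over the ground set X:
-- C ⊆ X and C satisfies every implication of Σ lying inside X.
InClosureOn : ∀ {n} → Base n → (X : Subset n) → Subset n → Set
InClosureOn {n} Σ X C =
  C ⊆ X × (∀ (i : Implication n) → i ∈ₗ Σ → InsideOf X i → premise i ⊆ C → conclusion i ∈ C)

-- (U₁ , ∁ U₁) is a split of Σ: both parts nonempty and every premise
-- is contained in U₁ or in U₂ = ∁ U₁.
IsSplit : ∀ {n} → Base n → Subset n → Set
IsSplit {n} Σ U₁ =
  Nonempty U₁ × Nonempty (∁ U₁) ×
  (∀ (i : Implication n) → i ∈ₗ Σ → premise i ⊆ U₁ ⊎ premise i ⊆ ∁ U₁)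

-- The split is acyclic: every implication of Σ[U₁,U₂] = Σ ∖ (Σ[U₁] ∪ Σ[U₂])
-- has its premise in U₁.
IsAcyclicSplit : ∀ {n} → Base n → Subset n → Set
IsAcyclicSplit {n} Σ U₁ =
  IsSplit Σ U₁ ×
  (∀ (i : Implication n) → i ∈ₗ Σ → ¬ InsideOf U₁ i → ¬ InsideOf (∁ U₁) i → premise i ⊆ U₁)

module Submission where

-- Take A → b in Σ with A ⊆ C₁′ ∪ C₂; since C₁′ ⊆ U₁ and C₂ ⊆ U₂, the premise,
-- lying in U₁ or in U₂, lies in C₁′ or in C₂.  If A ⊆ U₁ and b ∈ U₁ the
-- implication belongs to Σ[U₁], so b ∈ C₁′.  If A ⊆ U₁ and b ∈ U₂, then
-- A ⊆ C₁ and the closedness of C₁ ∪ C₂ puts b in C₁ ∪ C₂, hence in C₂.  If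
-- A ⊆ U₂, acyclicity forbids b ∈ U₁, so the implication belongs to Σ[U₂]
-- and b ∈ C₂.

open import Defs
open import Data.Nat using (ℕ)
open import Data.Fin using (Fin)
open import Data.Fin.Subset using (Subset; _⊆_; _∪_; ∁; _∈_; _∉_)
open import Data.Fin.Subset.Properties
  using (_∈?_; x∈p∪q⁻; x∈p∪q⁺; x∈∁p⇒x∉p; x∉p⇒x∈∁p; p⊆p∪q)
open import Data.List.Membership.Propositional using () renaming (_∈_ to _∈ₗ_)
open import Data.Product using (_,_; proj₁; proj₂)
open import Data.Sum using (inj₁; inj₂)
open import Data.Empty using (⊥-elim)
open import Function using (_∘_)
open import Relation.Nullary using (yes; no)

private
  variable
    n : ℕ
    x : Fin n
    X P C D : Subset n

x∈p∪q∧x∉p⇒x∈q : x ∈ C ∪ D → x ∉ C → x ∈ D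
x∈p∪q∧x∉p⇒x∈q {C = C} {D} x∈C∪D x∉C with x∈p∪q⁻ C D x∈C∪D
... | inj₁ x∈C = ⊥-elim (x∉C x∈C)
... | inj₂ x∈D = x∈D

x∈p∪q∧x∉q⇒x∈p : x ∈ C ∪ D → x ∉ D → x ∈ C
x∈p∪q∧x∉q⇒x∈p {C = C} {D} x∈C∪D x∉D with x∈p∪q⁻ C D x∈C∪D
... | inj₁ x∈C = x∈C
... | inj₂ x∈D = ⊥-elim (x∉D x∈D)

⊆∪-disjointʳ : D ⊆ ∁ X → P ⊆ X → P ⊆ C ∪ D → P ⊆ C
⊆∪-disjointʳ D⊆∁X P⊆X P⊆C∪D x∈P =
  x∈p∪q∧x∉q⇒x∈p (P⊆C∪D x∈P) (λ x∈D → x∈∁p⇒x∉p (D⊆∁X x∈D) (P⊆X x∈P))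

⊆∪-disjointˡ : C ⊆ X → P ⊆ ∁ X → P ⊆ C ∪ D → P ⊆ D
⊆∪-disjointˡ C⊆X P⊆∁X P⊆C∪D x∈P =
  x∈p∪q∧x∉p⇒x∈q (P⊆C∪D x∈P) (λ x∈C → x∈∁p⇒x∉p (P⊆∁X x∈P) (C⊆X x∈C))

module _ {Σ : Base n} {U₁ : Subset n} where

  acyclic⇒no-implication-into-U₁ :
    IsAcyclicSplit Σ U₁ → ∀ {i} → i ∈ₗ Σ → premise i ⊆ ∁ U₁ → conclusion i ∉ U₁
  acyclic⇒no-implication-into-U₁ (_ , acyclic) {i} i∈Σ A⊆U₂ b∈U₁ =
    a∉U₁ (acyclic i i∈Σ (λ inside → a∉U₁ (proj₁ inside a∈A))
                        (λ inside → x∈∁p⇒x∉p (proj₂ inside) b∈U₁)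
                        a∈A)
    where
    a∈A : proj₁ (nonempty i) ∈ premise i
    a∈A = proj₂ (nonempty i)
    a∉U₁ : proj₁ (nonempty i) ∉ U₁
    a∉U₁ = x∈∁p⇒x∉p (A⊆U₂ a∈A)

  module _ {C₁ C₁′ C₂ : Subset n}
           (closed₁ : InClosureOn Σ U₁ C₁) (closed₁′ : InClosureOn Σ U₁ C₁′)
           (C₁′⊆C₁ : C₁′ ⊆ C₁) (closed : InClosure Σ (C₁ ∪ C₂))
           {i : Implication n} (i∈Σ : i ∈ₗ Σ)
           where

    conclusion-of-premise⊆C₁′ :
      premise i ⊆ U₁ → premise i ⊆ C₁′ → conclusion i ∈ C₁′ ∪ C₂
    conclusion-of-premise⊆C₁′ A⊆U₁ A⊆C₁′ with conclusion i ∈? U₁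
    ... | yes b∈U₁ = x∈p∪q⁺ (inj₁ (proj₂ closed₁′ i i∈Σ (A⊆U₁ , b∈U₁) A⊆C₁′))
    ... | no  b∉U₁ = x∈p∪q⁺ (inj₂ (x∈p∪q∧x∉p⇒x∈q b∈C₁∪C₂ (b∉U₁ ∘ proj₁ closed₁)))
      where
      b∈C₁∪C₂ : conclusion i ∈ C₁ ∪ C₂
      b∈C₁∪C₂ = closed i i∈Σ (p⊆p∪q C₂ ∘ C₁′⊆C₁ ∘ A⊆C₁′)

  conclusion-of-premise⊆C₂ :
    IsAcyclicSplit Σ U₁ → InClosureOn Σ (∁ U₁) C →
    ∀ {i} → i ∈ₗ Σ → premise i ⊆ ∁ U₁ → premise i ⊆ C → conclusion i ∈ C
  conclusion-of-premise⊆C₂ split (_ , closed₂) {i} i∈Σ A⊆U₂ =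
    closed₂ i i∈Σ (A⊆U₂ , x∉p⇒x∈∁p (acyclic⇒no-implication-into-U₁ split i∈Σ A⊆U₂))

proposition6 : ∀ {n : ℕ} (Σ : Base n) (U₁ : Subset n) → IsAcyclicSplit Σ U₁ →
    ∀ (C₁ C₂ : Subset n) → InClosureOn Σ U₁ C₁ → InClosureOn Σ (∁ U₁) C₂ →
    InClosure Σ (C₁ ∪ C₂) →
    ∀ (C₁′ : Subset n) → InClosureOn Σ U₁ C₁′ → C₁′ ⊆ C₁ →
    InClosure Σ (C₁′ ∪ C₂)
proposition6 Σ U₁ split C₁ C₂ closed₁ closed₂ closed C₁′ closed₁′ C₁′⊆C₁ i i∈Σ A⊆C₁′∪C₂
  with proj₂ (proj₂ (proj₁ split)) i i∈Σ
... | inj₁ A⊆U₁ =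
  conclusion-of-premise⊆C₁′ closed₁ closed₁′ C₁′⊆C₁ closed i∈Σ A⊆U₁
    (⊆∪-disjointʳ (proj₁ closed₂) A⊆U₁ A⊆C₁′∪C₂)
... | inj₂ A⊆U₂ =
  x∈p∪q⁺ (inj₂ (conclusion-of-premise⊆C₂ split closed₂ i∈Σ A⊆U₂
    (⊆∪-disjointˡ (proj₁ closed₁′) A⊆U₂ A⊆C₁′∪C₂)))
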